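{- Let $\beta$ be a totally positive quadratic integer satisfying $\operatorname{Tr}\beta \leq \operatorname{Nm}\beta < 2\operatorname{Tr}\beta - 4$. Then for every integer $n \geq 0$, $p_\beta((\operatorname{Tr}\beta)\beta^n) = n+1$.
   Context: A quadratic integer is a root of a monic irreducible quadratic polynomial over $\mathbb{Z}$; it lies in a real quadratic field when real. For $\beta$ in a real quadratic field with conjugate $\beta'$, $\operatorname{Tr}\beta = \beta + \beta'$ and $\operatorname{Nm}\beta = \beta\beta'$; $\beta$ is totally positive if $\beta > 0$ and $\beta' > 0$. For $\beta, \alpha \in \mathbb{C}$, $p_\beta(\alpha) \in \mathbb{Z}_{\geq 0}\cup\{\infty\}$ denotes the number of expressions $\alpha = a_j\beta^j + \dots + a_1\beta + a_0$ with $j, a_i \in \mathbb{Z}_{\geq 0}$ and $a_j \neq 0$; equivalently, the number of polynomials $f(x) \in \mathbb{Z}_{\geq 0}[x]$ with $f(\beta) = \alpha$. -}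

module Defs where

open import Data.Nat using (ℕ; zero; suc)
open import Data.Integer using (ℤ; +_; _+_; _-_; _*_; -_; _<_; _≤_)
open import Data.List using (List; []; _∷_; _∷ʳ_; length)
open import Data.List.Membership.Propositional using (_∈_)
open import Data.List.Relation.Unary.All using (All)
open import Data.List.Relation.Unary.Unique.Propositional using (Unique)
open import Data.Product using (Σ; _×_; _,_; ∃; ∃-syntax)
open import Relation.Binary.PropositionalEquality using (_≡_; _≢_)
open import Relation.Nullary using (¬_)

-- A monic quadratic x² - t x + m over ℤ.
-- It is irreducible over ℤ iff it does not split as (x - r)(x - s) with
-- r, s ∈ ℤ (a monic quadratic can only factor into monic linear factors).
IrreducibleQuad : ℤ → ℤ → Set
IrreducibleQuad t m = ¬ (∃[ r ] ∃[ s ] ((r + s ≡ t) × (r * s ≡ m)))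

-- β a root of x² - t x + m (so Tr β = t, Nm β = m).  Elements of ℤ[β]
-- are represented as pairs (a , b) meaning a + b β; since β is irrational
-- (irreducible minimal polynomial) this representation is unique, so
-- equality of pairs is equality of the corresponding numbers.
Zβ : Set
Zβ = ℤ × ℤ

-- multiplication by β, using β² = t β - m
mulβ : ℤ → ℤ → Zβ → Zβ
mulβ t m (a , b) = (- (m * b) , a + t * b)

powβ : ℤ → ℤ → ℕ → Zβ
powβ t m zero    = (+ 1 , + 0)
powβ t m (suc n) = mulβ t m (powβ t m n)

scale : ℤ → Zβ → Zβ
scale c (a , b) = (c * a , c * b)

-- A polynomial with nonnegative integer coefficients, as its coefficient
-- list [a₀ , a₁ , … , a_j] (increasing degree).  Evaluation at β (Horner).
evalβ : ℤ → ℤ → List ℕ → Zβ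
evalβ t m []       = (+ 0 , + 0)
evalβ t m (a ∷ as) with mulβ t m (evalβ t m as)
... | (x , y) = (+ a + x , y)

LeadingNonzero : List ℕ → Set
LeadingNonzero f = ∃[ as ] ∃[ a ] ((f ≡ as ∷ʳ a) × (a ≢ 0))

IsRep : ℤ → ℤ → Zβ → List ℕ → Set
IsRep t m α f = LeadingNonzero f × (evalβ t m f ≡ α)

pβ≡ : ℤ → ℤ → Zβ → ℕ → Set
pβ≡ t m α k = Σ (List (List ℕ)) λ L →
  Unique L × (length L ≡ k) × All (IsRep t m α) L ×
  (∀ f → IsRep t m α f → f ∈ L)

module Submission where

-- Write t = K + 2 and m = t + a; the hypotheses say exactly a ≥ 0 and m < 2K.  Let β′ = t − β = m/β
-- be the conjugate.  If an expansion of tβʲ⁺¹ + u − vβ′ has lowest digit c, the remaining digits expand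
-- (tβʲ⁺¹ + u − vβ′ − c)/β = tβʲ + v − wβ′, where u + m w = c + t v.  Along any expansion of tβⁿ these
-- states (u, v) keep K u ≤ m v, which forces every carry w to be nonnegative.  At the last level the
-- remaining value t + u − vβ′ is what a single digit plus β times a polynomial value gives, and every
-- polynomial value x − yβ′ satisfies K y < x or is 0; this leaves only the states (0,0), (0,1) and (1,1).
-- From (0,0) an expansion therefore reads 0, …, 0 and then either t, or m, 0, 1, or m, a, a+1, …, a+1, 1, 1:
-- one expansion for each position of its first nonzero digit, n + 1 in all.

open import Defs
open import Data.Nat as ℕ using (ℕ; zero; suc; z≤n; s≤s; z<s; NonZero; >-nonZero⁻¹)
import Data.Nat.Properties as ℕ
open import Data.Integer as ℤ using (ℤ; +_; -[1+_])
import Data.Integer.Properties as ℤ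
open import Data.List using (List; []; _∷_; _∷ʳ_; map; length)
open import Data.List.Properties using (length-map; ∷-injectiveʳ)
open import Data.List.Membership.Propositional using (_∈_)
open import Data.List.Membership.Propositional.Properties using (∈-map⁺; ∈-map⁻)
open import Data.List.Relation.Unary.Any using (here; there)
open import Data.List.Relation.Unary.All as All using (All)
import Data.List.Relation.Unary.All.Properties as Allₚ
import Data.List.Relation.Unary.AllPairs as AllPairs
open import Data.List.Relation.Unary.Unique.Propositional using (Unique)
import Data.List.Relation.Unary.Unique.Propositional.Properties as Unique
open import Data.Product using (Σ-syntax; _×_; _,_; proj₁; proj₂)
open import Data.Sum using (_⊎_; inj₁; inj₂)
open import Data.Empty using (⊥; ⊥-elim)
open import Data.Unit using (⊤; tt)
open import Relation.Nullary using (¬_)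
open import Relation.Binary.PropositionalEquality
  using (_≡_; _≢_; refl; sym; trans; cong; cong₂; subst; module ≡-Reasoning)

module HornerStep (t m : ℤ) where
  open import Data.Integer using (_+_; _-_; _*_; -_)
  open import Data.Integer.Tactic.RingSolver using (solve)
  open import Algebra.Bundles using (AbelianGroup)
  open import Algebra.Properties.Group (AbelianGroup.group ℤ.+-0-abelianGroup)
    using (quasigroup; //-rightDividesˡ)
  open import Algebra.Properties.Quasigroup quasigroup using (cancelˡ; cancelʳ; x≈z//y)

  horner : ℕ → Zβ → Zβ
  horner c α = (+ c + proj₁ (mulβ t m α) , proj₂ (mulβ t m α))

  -- shift P u v is P + u − vβ′, where β′ = t − β is the conjugate of β.
  shift : Zβ → ℤ → ℤ → Zβ
  shift (p , q) u v = (p + (u - t * v) , q + v)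

  shift-injective : ∀ P {u u′ v v′} → shift P u v ≡ shift P u′ v′ → u ≡ u′ × v ≡ v′
  shift-injective (p , q) {v = v} eq with cancelˡ q _ _ (cong proj₂ eq)
  ... | refl = cancelʳ (- (t * v)) _ _ (cancelˡ p _ _ (cong proj₁ eq)) , refl

  shift-surjective : ∀ P α → Σ[ v ∈ ℤ ] Σ[ w ∈ ℤ ] α ≡ shift P v w
  shift-surjective (p , q) (x , y) = x - p + t * (y - q) , y - q , cong₂ _,_ first second
    where
    first : x ≡ p + ((x - p + t * (y - q)) - t * (y - q))
    first = solve (x ∷ y ∷ p ∷ q ∷ t ∷ [])
    second : y ≡ q + (y - q)
    second = solve (y ∷ q ∷ [])

  horner-shift : ∀ c P v w → horner c (shift P v w) ≡ shift (mulβ t m P) (+ c + t * v - m * w) v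
  horner-shift c (p , q) v w = cong₂ _,_ (first (+ c)) second
    where
    first : ∀ d → d + - (m * (q + w)) ≡ - (m * q) + ((d + t * v - m * w) - t * v)
    first d = solve (d ∷ q ∷ v ∷ w ∷ t ∷ m ∷ [])
    second : p + (v - t * w) + t * (q + w) ≡ p + t * q + v
    second = solve (p ∷ q ∷ v ∷ w ∷ t ∷ [])

  divide : ∀ c α P {P′} u v → mulβ t m P ≡ P′ → horner c α ≡ shift P′ u v →
           Σ[ w ∈ ℤ ] α ≡ shift P v w × u + m * w ≡ + c + t * v
  divide c α P u v refl eq =
    w , subst (λ x → α ≡ shift P x w) v′≡v α≡ , trans (cong (_+ m * w) u≡) (//-rightDividesˡ (m * w) _)
    where
    v′ w : ℤ
    v′ = proj₁ (shift-surjective P α)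
    w  = proj₁ (proj₂ (shift-surjective P α))
    α≡ : α ≡ shift P v′ w
    α≡ = proj₂ (proj₂ (shift-surjective P α))
    components : + c + t * v′ - m * w ≡ u × v′ ≡ v
    components = shift-injective (mulβ t m P)
      (trans (sym (horner-shift c P v′ w)) (trans (cong (horner c) (sym α≡)) eq))
    v′≡v : v′ ≡ v
    v′≡v = proj₂ components
    u≡ : u ≡ + c + t * v - m * w
    u≡ = subst (λ x → u ≡ + c + t * x - m * w) v′≡v (sym (proj₁ components))

  attach : ∀ c P {α P′} u v w → mulβ t m P ≡ P′ → α ≡ shift P v w →
           u + m * w ≡ + c + t * v → horner c α ≡ shift P′ u v
  attach c P u v w refl refl carry =
    trans (horner-shift c P v w) (cong (λ x → shift (mulβ t m P) x v) (sym (x≈z//y u (m * w) _ carry)))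

  origin : Zβ
  origin = (+ 0 , + 0)

  offset : ℤ → ℤ → Zβ
  offset = shift origin

  target : ℕ → ℤ → ℤ → Zβ
  target j = shift (scale t (powβ t m j))

  mulβ-origin : mulβ t m origin ≡ origin
  mulβ-origin = cong₂ _,_ first second
    where
    first : - (m * + 0) ≡ + 0
    first = solve (m ∷ [])
    second : + 0 + t * + 0 ≡ + 0
    second = solve (t ∷ [])

  mulβ-scale : ∀ P → mulβ t m (scale t P) ≡ scale t (mulβ t m P)
  mulβ-scale (p , q) = cong₂ _,_ first second
    where
    first : - (m * (t * q)) ≡ t * - (m * q)
    first = solve (t ∷ m ∷ q ∷ [])
    second : t * p + t * (t * q) ≡ t * (p + t * q)
    second = solve (t ∷ p ∷ q ∷ [])

  horner-0-origin : horner 0 origin ≡ origin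
  horner-0-origin = cong₂ _,_ first second
    where
    first : + 0 + - (m * + 0) ≡ + 0
    first = solve (m ∷ [])
    second : + 0 + t * + 0 ≡ + 0
    second = solve (t ∷ [])

  origin≡offset : origin ≡ offset (+ 0) (+ 0)
  origin≡offset = cong₂ _,_ first refl
    where
    first : + 0 ≡ + 0 + (+ 0 - t * + 0)
    first = solve (t ∷ [])

  target-zero : ∀ u v → target 0 u v ≡ offset (t + u) v
  target-zero u v = cong₂ _,_ first second
    where
    first : t * + 1 + (u - t * v) ≡ + 0 + (t + u - t * v)
    first = solve (t ∷ u ∷ v ∷ [])
    second : t * + 0 + v ≡ + 0 + v
    second = solve (t ∷ v ∷ [])

  target-origin : ∀ j → target j (+ 0) (+ 0) ≡ scale t (powβ t m j)
  target-origin j = cong₂ _,_ (first (t * proj₁ (powβ t m j))) (second (t * proj₂ (powβ t m j)))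
    where
    first : ∀ x → x + (+ 0 - t * + 0) ≡ x
    first x = solve (x ∷ t ∷ [])
    second : ∀ y → y + + 0 ≡ y
    second y = solve (y ∷ [])

module PosCarry where
  open import Data.Integer using (_+_; _*_; -_)
  open import Data.Integer.Properties using (pos-*; +-injective)
  open import Data.Integer.Tactic.RingSolver using (solve)
  open ≡-Reasoning

  pos-carry : ∀ {T M u v c w} → u ℕ.+ M ℕ.* w ≡ c ℕ.+ T ℕ.* v → + u + + M * + w ≡ + c + + T * + v
  pos-carry {T} {M} {u} {v} {c} {w} eq = begin
    + u + + M * + w   ≡⟨ cong (_+_ (+ u)) (pos-* M w) ⟨
    + (u ℕ.+ M ℕ.* w) ≡⟨ cong +_ eq ⟩
    + (c ℕ.+ T ℕ.* v) ≡⟨ cong (_+_ (+ c)) (pos-* T v) ⟩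
    + c + + T * + v   ∎

  pos-carry⁻¹ : ∀ {T M u v c w} → + u + + M * + w ≡ + c + + T * + v → u ℕ.+ M ℕ.* w ≡ c ℕ.+ T ℕ.* v
  pos-carry⁻¹ {T} {M} {u} {v} {c} {w} eq = +-injective (begin
    + (u ℕ.+ M ℕ.* w) ≡⟨ cong (_+_ (+ u)) (pos-* M w) ⟩
    + u + + M * + w   ≡⟨ eq ⟩
    + c + + T * + v   ≡⟨ cong (_+_ (+ c)) (pos-* T v) ⟨
    + (c ℕ.+ T ℕ.* v) ∎)

  neg-carry⁻¹ : ∀ {T M u v c j} → + u + + M * -[1+ j ] ≡ + c + + T * + v →
                u ≡ c ℕ.+ T ℕ.* v ℕ.+ M ℕ.* suc j
  neg-carry⁻¹ {T} {M} {u} {v} {c} {j} eq = +-injective (begin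
    + u                                   ≡⟨ move (+ u) (+ M) (+ suc j) ⟩
    + u + + M * - + suc j + + M * + suc j ≡⟨ cong (_+ + M * + suc j) eq ⟩
    + c + + T * + v + + M * + suc j       ≡⟨ cong₂ (λ x y → + c + x + y) (pos-* T v) (pos-* M (suc j)) ⟨
    + (c ℕ.+ T ℕ.* v ℕ.+ M ℕ.* suc j)     ∎)
    where
    move : ∀ x y z → x ≡ x + y * - z + y * z
    move x y z = solve (x ∷ y ∷ z ∷ [])

module CarryArithmetic where
  open import Data.Nat using (_+_; _*_; _≤_; _<_)
  open import Data.Nat.Properties
  open import Data.Nat.Tactic.RingSolver using (solve)

  k*[k*v]+m*v≤k*[[2+k]*v] : ∀ k {m} v → m ≤ 2 * k → k * (k * v) + m * v ≤ k * ((2 + k) * v)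
  k*[k*v]+m*v≤k*[[2+k]*v] k {m} v m≤2k = begin
    k * (k * v) + m * v     ≤⟨ +-monoʳ-≤ (k * (k * v)) (*-monoˡ-≤ v m≤2k) ⟩
    k * (k * v) + 2 * k * v ≡⟨ solve (k ∷ v ∷ []) ⟩
    k * ((2 + k) * v)       ∎
    where open ≤-Reasoning

  carry-bound : ∀ k {m} x {u v c w} .{{_ : NonZero k}} → m ≤ 2 * k →
                k * u ≤ k * x + m * v → u + m * w ≡ c + (2 + k) * v → k * v ≤ x + m * w
  carry-bound k {m} x {u} {v} {c} {w} m≤2k ku≤kx+mv carry =
    *-cancelˡ-≤ k (+-cancelʳ-≤ (m * v) (k * (k * v)) (k * (x + m * w)) (begin
      k * (k * v) + m * v         ≤⟨ k*[k*v]+m*v≤k*[[2+k]*v] k v m≤2k ⟩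
      k * ((2 + k) * v)           ≤⟨ *-monoʳ-≤ k (m≤n+m ((2 + k) * v) c) ⟩
      k * (c + (2 + k) * v)       ≡⟨ cong (k *_) carry ⟨
      k * (u + m * w)             ≡⟨ *-distribˡ-+ k u (m * w) ⟩
      k * u + k * (m * w)         ≤⟨ +-monoˡ-≤ (k * (m * w)) ku≤kx+mv ⟩
      k * x + m * v + k * (m * w) ≡⟨ solve (k ∷ x ∷ m ∷ v ∷ w ∷ []) ⟩
      k * (x + m * w) + m * v     ∎))
    where open ≤-Reasoning

  no-negative-carry : ∀ k {m u v c j} .{{_ : NonZero k}} .{{_ : NonZero m}} → m ≤ 2 * k →
                      k * u ≤ m * v → u ≡ c + (2 + k) * v + m * suc j → ⊥
  no-negative-carry k {m} {u} {v} {c} {j} m≤2k ku≤mv refl = <-irrefl refl (begin-strict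
    m * v                             ≤⟨ m≤n+m (m * v) (k * (k * v)) ⟩
    k * (k * v) + m * v               ≤⟨ k*[k*v]+m*v≤k*[[2+k]*v] k v m≤2k ⟩
    k * ((2 + k) * v)                 <⟨ *-monoʳ-< k (m<m+n _ (>-nonZero⁻¹ (m * suc j) {{m*n≢0 m (suc j)}})) ⟩
    k * ((2 + k) * v + m * suc j)     ≤⟨ *-monoʳ-≤ k (+-monoˡ-≤ (m * suc j) (m≤n+m _ c)) ⟩
    k * (c + (2 + k) * v + m * suc j) ≤⟨ ku≤mv ⟩
    m * v                             ∎)
    where open ≤-Reasoning

  -- In Expansions, every value x − yβ′ of a polynomial with nonnegative coefficients has Cone K x y.
  data Cone (k : ℕ) : ℕ → ℕ → Set where
    apex     : Cone k 0 0
    interior : ∀ {x y} → k * y < x → Cone k x y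

  cone-axis : ∀ k x → Cone k x 0
  cone-axis k zero    = apex
  cone-axis k (suc x) = interior (subst (_< suc x) (sym (*-zeroʳ k)) z<s)

  cone-step : ∀ k {m s} c {x y} → m + s ≡ 2 * k → Cone k x y →
              Σ[ x′ ∈ ℕ ] x′ + m * y ≡ c + (2 + k) * x × Cone k x′ x
  cone-step k {m} c m+s≡2k apex =
    c , cong (_+_ c) (trans (*-zeroʳ m) (sym (*-zeroʳ (2 + k)))) , cone-axis k c
  cone-step k {m} {s} c {x} {y} m+s≡2k (interior ky<x) with m≤n⇒∃[o]m+o≡n ky<x
  ... | e , x≡ = k * x + (2 * (1 + e) + c + s * y) , carry , interior (m<m+n (k * x) z<s)
    where
    open ≡-Reasoning
    carry : k * x + (2 * (1 + e) + c + s * y) + m * y ≡ c + (2 + k) * x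
    carry = begin
      k * x + (2 * (1 + e) + c + s * y) + m * y ≡⟨ solve (k ∷ x ∷ e ∷ c ∷ s ∷ y ∷ m ∷ []) ⟩
      k * x + 2 * (1 + e) + c + (m + s) * y     ≡⟨ cong (λ z → k * x + 2 * (1 + e) + c + z * y) m+s≡2k ⟩
      k * x + 2 * (1 + e) + c + 2 * k * y       ≡⟨ solve (k ∷ x ∷ y ∷ e ∷ c ∷ []) ⟩
      c + k * x + 2 * (1 + k * y + e)           ≡⟨ cong (λ z → c + k * x + 2 * z) x≡ ⟩
      c + k * x + 2 * x                         ≡⟨ solve (c ∷ k ∷ x ∷ []) ⟩
      c + (2 + k) * x                           ∎

  k*u≤m*0⇒u≡0 : ∀ k {m u} .{{_ : NonZero k}} → k * u ≤ m * 0 → u ≡ 0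
  k*u≤m*0⇒u≡0 k {m} ku≤m0 =
    n≤0⇒n≡0 (*-cancelˡ-≤ k (≤-trans ku≤m0 (≤-reflexive (trans (*-zeroʳ m) (sym (*-zeroʳ k))))))

  k*u≤m*1⇒u<2 : ∀ k {m u} → m < 2 * k → k * u ≤ m * 1 → u < 2
  k*u≤m*1⇒u<2 k {m} {u} m<2k ku≤m = *-cancelˡ-< k u 2 (begin-strict
    k * u ≤⟨ ku≤m ⟩
    m * 1 ≡⟨ *-identityʳ m ⟩
    m     <⟨ m<2k ⟩
    2 * k ≡⟨ *-comm 2 k ⟩
    k * 2 ∎)
    where open ≤-Reasoning

  m+4≤k*k : ∀ k {m} → 3 ≤ k → m < 2 * k → m + 4 ≤ k * k
  m+4≤k*k k {m} 3≤k m<2k = begin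
    m + 4     ≡⟨ +-comm m 4 ⟩
    3 + suc m ≤⟨ +-monoʳ-≤ 3 m<2k ⟩
    3 + 2 * k ≤⟨ +-monoˡ-≤ (2 * k) 3≤k ⟩
    k + 2 * k ≡⟨ solve (k ∷ []) ⟩
    3 * k     ≤⟨ *-monoˡ-≤ k 3≤k ⟩
    k * k     ∎
    where open ≤-Reasoning

  level-zero-carry : ∀ k {m v w} → 3 ≤ k → m < 2 * k →
                     k * v ≤ (2 + k) + m * w → k * w < v → w ≡ 0 × v ≡ 1
  level-zero-carry k {m} {v} {zero} 3≤k m<2k kv≤2+k+m*0 k*0<v =
    refl , ≤-antisym (≤-pred v<2) (subst (_< v) (*-zeroʳ k) k*0<v)
    where
    open ≤-Reasoning
    v<2 : v < 2
    v<2 = *-cancelˡ-< k v 2 (begin-strict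
      k * v         ≤⟨ kv≤2+k+m*0 ⟩
      2 + k + m * 0 ≡⟨ cong (_+_ (2 + k)) (*-zeroʳ m) ⟩
      2 + k + 0     ≡⟨ +-identityʳ (2 + k) ⟩
      2 + k         <⟨ +-monoˡ-< k 3≤k ⟩
      k + k         ≡⟨ solve (k ∷ []) ⟩
      k * 2         ∎)
  level-zero-carry k {m} {v} {suc w} 3≤k m<2k kv≤2+k+mw kw<v = ⊥-elim (<-irrefl refl (begin-strict
    2 + k + m * (1 + w)             ≡⟨ solve (k ∷ m ∷ w ∷ []) ⟩
    k + (m * (1 + w) + 2)           <⟨ +-monoʳ-< k (+-monoʳ-< (m * (1 + w)) 2<4*[1+w]) ⟩
    k + (m * (1 + w) + 4 * (1 + w)) ≡⟨ solve (k ∷ m ∷ w ∷ []) ⟩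
    k + (m + 4) * (1 + w)           ≤⟨ +-monoʳ-≤ k (*-monoˡ-≤ (1 + w) (m+4≤k*k k 3≤k m<2k)) ⟩
    k + k * k * (1 + w)             ≡⟨ solve (k ∷ w ∷ []) ⟩
    k * (1 + k * (1 + w))           ≤⟨ *-monoʳ-≤ k kw<v ⟩
    k * v                           ≤⟨ kv≤2+k+mw ⟩
    2 + k + m * (1 + w)             ∎))
    where
    open ≤-Reasoning
    2<4*[1+w] : 2 < 4 * (1 + w)
    2<4*[1+w] = <-≤-trans (s≤s (s≤s (s≤s z≤n))) (m≤m*n 4 (1 + w))

NoTrailingZero : List ℕ → Set
NoTrailingZero []           = ⊤
NoTrailingZero (c ∷ [])     = c ≢ 0
NoTrailingZero (_ ∷ d ∷ ds) = NoTrailingZero (d ∷ ds)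

NoTrailingZero-tail : ∀ c ds → NoTrailingZero (c ∷ ds) → NoTrailingZero ds
NoTrailingZero-tail c []      _  = tt
NoTrailingZero-tail c (_ ∷ _) nz = nz

NoTrailingZero-∷ʳ : ∀ ds {c} → c ≢ 0 → NoTrailingZero (ds ∷ʳ c)
NoTrailingZero-∷ʳ []           c≢0 = c≢0
NoTrailingZero-∷ʳ (_ ∷ [])     c≢0 = c≢0
NoTrailingZero-∷ʳ (_ ∷ d ∷ ds) c≢0 = NoTrailingZero-∷ʳ (d ∷ ds) c≢0

LeadingNonzero⇒NoTrailingZero : ∀ f → LeadingNonzero f → NoTrailingZero f
LeadingNonzero⇒NoTrailingZero _ (ds , _ , refl , c≢0) = NoTrailingZero-∷ʳ ds c≢0

LeadingNonzero-∷ : ∀ c {f} → LeadingNonzero f → LeadingNonzero (c ∷ f)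
LeadingNonzero-∷ c (ds , d , refl , d≢0) = c ∷ ds , d , refl , d≢0

module Expansions (K a : ℕ) (M<2K : 2 ℕ.+ K ℕ.+ a ℕ.< 2 ℕ.* K) where
  open import Data.Nat using (_+_; _*_; _≤_; _<_; >-nonZero)
  open import Data.Nat.Properties
  open import Data.Nat.Tactic.RingSolver using (solve-∀)
  open CarryArithmetic
  open PosCarry

  T M : ℕ
  T = 2 + K
  M = T + a

  open HornerStep (+ T) (+ M)

  ev : List ℕ → Zβ
  ev = evalβ (+ T) (+ M)

  M≤2K : M ≤ 2 * K
  M≤2K = <⇒≤ M<2K

  3≤K : 3 ≤ K
  3≤K = +-cancelʳ-≤ K 3 K (begin
    3 + K     ≤⟨ m≤m+n (3 + K) a ⟩
    3 + K + a ≤⟨ M<2K ⟩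
    2 * K     ≡⟨ cong (_+_ K) (+-identityʳ K) ⟩
    K + K     ∎)
    where open ≤-Reasoning

  instance
    K-nonZero : NonZero K
    K-nonZero = >-nonZero (<-≤-trans z<s 3≤K)

  M+s≡2K : Σ[ s ∈ ℕ ] M + s ≡ 2 * K
  M+s≡2K = m≤n⇒∃[o]m+o≡n M≤2K

  -- A state (u, v) at level j stands for the value target j (+ u) (+ v) = tβʲ + u − vβ′ still to be expanded.
  Admissible : ℕ → ℕ → Set
  Admissible u v = K * u ≤ M * v

  record Step (u v c w : ℕ) : Set where
    constructor step
    field carry : u + M * w ≡ c + T * v

  step-unique : ∀ {u v c d w} → Step u v c w → Step u v d w → c ≡ d
  step-unique {v = v} {c} {d} (step s) (step s′) = +-cancelʳ-≡ (T * v) c d (trans (sym s) s′)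

  step-axis : ∀ x → Step x 0 x 0
  step-axis x = step (cong (_+_ x) (trans (*-zeroʳ M) (sym (*-zeroʳ T))))

  step-[t] : Step (T + 0) 0 T 0
  step-[t] = step (identity T M)
    where
    identity : ∀ t m → t + 0 + m * 0 ≡ t + t * 0
    identity = solve-∀

  step-[u∷1] : ∀ u → Step (T + u) 1 u 0
  step-[u∷1] u = step (identity T M u)
    where
    identity : ∀ t m u → t + u + m * 0 ≡ u + t * 1
    identity = solve-∀

  step₀₀₁ : Step 0 0 M 1
  step₀₀₁ = step (identity T M)
    where
    identity : ∀ t m → 0 + m * 1 ≡ m + t * 0
    identity = solve-∀

  step₀₁₁ : Step 0 1 a 1
  step₀₁₁ = step (identity T a)
    where
    identity : ∀ t a → 0 + (t + a) * 1 ≡ a + t * 1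
    identity = solve-∀

  step₁₁₁ : Step 1 1 (1 + a) 1
  step₁₁₁ = step (identity T a)
    where
    identity : ∀ t a → 1 + (t + a) * 1 ≡ 1 + a + t * 1
    identity = solve-∀

  eval-∷-offset : ∀ g {c x′ x y} → ev g ≡ offset (+ x) (+ y) → Step x′ x c y →
                  ev (c ∷ g) ≡ offset (+ x′) (+ x)
  eval-∷-offset g {c} {x′} {x} {y} g≡ (step s) =
    attach c origin (+ x′) (+ x) (+ y) mulβ-origin g≡ (pos-carry {T} {M} {x′} {x} {c} {y} s)

  eval-∷-target : ∀ j {g c u v w} → ev g ≡ target j (+ v) (+ w) → Step u v c w →
                  ev (c ∷ g) ≡ target (suc j) (+ u) (+ v)
  eval-∷-target j {c = c} {u} {v} {w} g≡ (step s) =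
    attach c (scale (+ T) (powβ (+ T) (+ M) j)) (+ u) (+ v) (+ w) (mulβ-scale (powβ (+ T) (+ M) j)) g≡
      (pos-carry {T} {M} {u} {v} {c} {w} s)

  eval-in-cone : ∀ g → Σ[ x ∈ ℕ ] Σ[ y ∈ ℕ ] ev g ≡ offset (+ x) (+ y) × Cone K x y
  eval-in-cone []      = 0 , 0 , origin≡offset , apex
  eval-in-cone (c ∷ g) with eval-in-cone g
  ... | x , y , g≡ , cone with cone-step K {M} {proj₁ M+s≡2K} c (proj₂ M+s≡2K) cone
  ... | x′ , s , cone′ = x′ , x , eval-∷-offset g g≡ (step s) , cone′

  descend-offset : ∀ c g {x′ x} → ev (c ∷ g) ≡ offset (+ x′) (+ x) →
                   Σ[ y ∈ ℕ ] ev g ≡ offset (+ x) (+ y) × Step x′ x c y × Cone K x y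
  descend-offset c g {x′} {x} eq =
    combine (divide c (ev g) origin (+ x′) (+ x) mulβ-origin eq) (eval-in-cone g)
    where
    combine : Σ[ W ∈ ℤ ] ev g ≡ offset (+ x) W × + x′ ℤ.+ + M ℤ.* W ≡ + c ℤ.+ + T ℤ.* + x →
              Σ[ x₀ ∈ ℕ ] Σ[ y ∈ ℕ ] ev g ≡ offset (+ x₀) (+ y) × Cone K x₀ y →
              Σ[ y ∈ ℕ ] ev g ≡ offset (+ x) (+ y) × Step x′ x c y × Cone K x y
    combine (W , g≡ , carry) (x₀ , y , g≡₀ , cone)
      with shift-injective origin {+ x} {+ x₀} {W} {+ y} (trans (sym g≡) g≡₀)
    ... | refl , refl = y , g≡₀ , step (pos-carry⁻¹ {T} {M} {x′} {x} {c} {y} carry) , cone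

  descend : ∀ j u v c α → Admissible u v → horner c α ≡ target (suc j) (+ u) (+ v) →
            Σ[ w ∈ ℕ ] α ≡ target j (+ v) (+ w) × Step u v c w × Admissible v w
  descend j u v c α adm eq = nonnegative-carry
    (divide c α (scale (+ T) (powβ (+ T) (+ M) j)) (+ u) (+ v) (mulβ-scale (powβ (+ T) (+ M) j)) eq)
    where
    nonnegative-carry : Σ[ W ∈ ℤ ] α ≡ target j (+ v) W × + u ℤ.+ + M ℤ.* W ≡ + c ℤ.+ + T ℤ.* + v →
                        Σ[ w ∈ ℕ ] α ≡ target j (+ v) (+ w) × Step u v c w × Admissible v w
    nonnegative-carry (+ w , α≡ , carry) =
      w , α≡ , step s , carry-bound K {M} 0 {u} {v} {c} {w} M≤2K (≤-trans adm (m≤n+m (M * v) (K * 0))) s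
      where
      s : u + M * w ≡ c + T * v
      s = pos-carry⁻¹ {T} {M} {u} {v} {c} {w} carry
    nonnegative-carry (-[1+ k ] , _ , carry) =
      ⊥-elim (no-negative-carry K {M} {u} {v} {c} {k} M≤2K adm (neg-carry⁻¹ {T} {M} {u} {v} {c} {k} carry))

  integer-expansion : ∀ n g → NoTrailingZero g → ev g ≡ offset (+ n) (+ 0) → n ≡ 0 × g ≡ [] ⊎ g ≡ n ∷ []
  integer-expansion n [] _ eq with shift-injective origin {+ 0} {+ n} {+ 0} {+ 0} (trans (sym origin≡offset) eq)
  ... | refl , _ = inj₁ (refl , refl)
  integer-expansion n (c ∷ g) nz eq = after-descent (descend-offset c g eq)
    where
    after-descent : Σ[ y ∈ ℕ ] ev g ≡ offset (+ 0) (+ y) × Step n 0 c y × Cone K 0 y →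
                    n ≡ 0 × c ∷ g ≡ [] ⊎ c ∷ g ≡ n ∷ []
    after-descent (_ , _ , _ , interior ())
    after-descent (0 , g≡ , s , apex) with integer-expansion 0 g (NoTrailingZero-tail c g nz) g≡
    ... | inj₁ (_ , g≡[]) = inj₂ (cong₂ _∷_ (step-unique s (step-axis n)) g≡[])
    ... | inj₂ g≡[0]      = ⊥-elim (subst (λ h → NoTrailingZero (c ∷ h)) g≡[0] nz refl)

  rep₁₁ : ℕ → List ℕ
  rep₁₁ zero    = 1 ∷ 1 ∷ []
  rep₁₁ (suc j) = suc a ∷ rep₁₁ j

  rep₀₁ : ℕ → List ℕ
  rep₀₁ zero    = 0 ∷ 1 ∷ []
  rep₀₁ (suc j) = a ∷ rep₁₁ j

  reps : ℕ → List (List ℕ)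
  reps zero    = (T ∷ []) ∷ []
  reps (suc j) = (M ∷ rep₀₁ j) ∷ map (0 ∷_) (reps j)

  data Listed (j : ℕ) : ℕ → ℕ → List ℕ → Set where
    listed₀₀ : ∀ {f} → f ∈ reps j → Listed j 0 0 f
    listed₀₁ : Listed j 0 1 (rep₀₁ j)
    listed₁₁ : Listed j 1 1 (rep₁₁ j)

  ¬Listed-[] : ∀ j {u v} → ¬ Listed j u v []
  ¬Listed-[] zero    (listed₀₀ (here ()))
  ¬Listed-[] zero    (listed₀₀ (there ()))
  ¬Listed-[] (suc j) (listed₀₀ (here ()))
  ¬Listed-[] (suc j) (listed₀₀ (there []∈)) with ∈-map⁻ (0 ∷_) []∈
  ... | _ , _ , ()

  listed-∷ : ∀ {j u v w c g} → Admissible u v → Step u v c w → Listed j v w g → Listed (suc j) u v (c ∷ g)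
  listed-∷ {u = u} adm s (listed₀₀ g∈) with k*u≤m*0⇒u≡0 K {M} {u} adm
  ... | refl with step-unique s (step-axis 0)
  ... | refl = listed₀₀ (there (∈-map⁺ (0 ∷_) g∈))
  listed-∷ {u = u} adm s listed₀₁ with k*u≤m*0⇒u≡0 K {M} {u} adm
  ... | refl with step-unique s step₀₀₁
  ... | refl = listed₀₀ (here refl)
  listed-∷ {u = 0} adm s listed₁₁ with step-unique s step₀₁₁
  ... | refl = listed₀₁
  listed-∷ {u = 1} adm s listed₁₁ with step-unique s step₁₁₁
  ... | refl = listed₁₁
  listed-∷ {u = suc (suc u)} adm s listed₁₁ with k*u≤m*1⇒u<2 K {M} {suc (suc u)} M<2K adm
  ... | s≤s (s≤s ())

  listed-[u∷1] : ∀ u → u < 2 → Listed 0 u 1 (u ∷ 1 ∷ [])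
  listed-[u∷1] 0             _               = listed₀₁
  listed-[u∷1] 1             _               = listed₁₁
  listed-[u∷1] (suc (suc _)) (s≤s (s≤s ()))

  listed-zero : ∀ u v g → Admissible u v → NoTrailingZero g → ev g ≡ offset (+ (T + u)) (+ v) → Listed 0 u v g
  listed-zero u v [] _ _ eq with shift-injective origin {+ 0} {+ (T + u)} {+ 0} {+ v} (trans (sym origin≡offset) eq)
  ... | () , _
  listed-zero u v (c ∷ g) adm nz eq = after-descent (descend-offset c g eq)
    where
    K[T+u]≤KT+Mv : K * (T + u) ≤ K * T + M * v
    K[T+u]≤KT+Mv = ≤-trans (≤-reflexive (*-distribˡ-+ K T u)) (+-monoʳ-≤ (K * T) adm)

    after-descent : Σ[ y ∈ ℕ ] ev g ≡ offset (+ v) (+ y) × Step (T + u) v c y × Cone K v y → Listed 0 u v (c ∷ g)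
    after-descent (y , g≡ , s , apex) =
      subst (λ u → Listed 0 u 0 (c ∷ g)) (sym u≡0) (listed₀₀ (here (cong₂ _∷_ c≡T g≡[])))
      where
      u≡0 : u ≡ 0
      u≡0 = k*u≤m*0⇒u≡0 K {M} {u} adm
      c≡T : c ≡ T
      c≡T = step-unique (subst (λ u → Step (T + u) 0 c 0) u≡0 s) step-[t]
      g≡[] : g ≡ []
      g≡[] with integer-expansion 0 g (NoTrailingZero-tail c g nz) g≡
      ... | inj₁ (_ , g≡[]) = g≡[]
      ... | inj₂ g≡[0]      = ⊥-elim (subst (λ h → NoTrailingZero (c ∷ h)) g≡[0] nz refl)
    after-descent (y , g≡ , s , interior Ky<v)
      with level-zero-carry K 3≤K M<2K (carry-bound K {M} T {T + u} {v} {c} {y} M≤2K K[T+u]≤KT+Mv (Step.carry s)) Ky<v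
    ... | refl , refl with integer-expansion 1 g (NoTrailingZero-tail c g nz) g≡
    ...   | inj₂ g≡[1] = subst (Listed 0 u 1) (sym (cong₂ _∷_ (step-unique s (step-[u∷1] u)) g≡[1]))
                               (listed-[u∷1] u (k*u≤m*1⇒u<2 K {M} {u} M<2K adm))

  listed : ∀ j u v g → Admissible u v → NoTrailingZero g → ev g ≡ target j (+ u) (+ v) → Listed j u v g
  listed zero    u v g       adm nz eq = listed-zero u v g adm nz (trans eq (target-zero (+ u) (+ v)))
  listed (suc j) u v []      adm _  eq = absurd (descend j u v 0 origin adm (trans horner-0-origin eq))
    where
    absurd : Σ[ w ∈ ℕ ] origin ≡ target j (+ v) (+ w) × Step u v 0 w × Admissible v w → Listed (suc j) u v []
    absurd (w , []≡ , _ , adm′) = ⊥-elim (¬Listed-[] j (listed j v w [] adm′ tt []≡))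
  listed (suc j) u v (c ∷ g) adm nz eq = extend (descend j u v c (ev g) adm eq)
    where
    extend : Σ[ w ∈ ℕ ] ev g ≡ target j (+ v) (+ w) × Step u v c w × Admissible v w → Listed (suc j) u v (c ∷ g)
    extend (w , g≡ , s , adm′) = listed-∷ adm s (listed j v w g adm′ (NoTrailingZero-tail c g nz) g≡)

  eval-[1] : ev (1 ∷ []) ≡ offset (+ 1) (+ 0)
  eval-[1] = eval-∷-offset [] origin≡offset (step-axis 1)

  eval-rep₁₁ : ∀ j → ev (rep₁₁ j) ≡ target j (+ 1) (+ 1)
  eval-rep₁₁ zero    = trans (eval-∷-offset (1 ∷ []) eval-[1] (step-[u∷1] 1)) (sym (target-zero (+ 1) (+ 1)))
  eval-rep₁₁ (suc j) = eval-∷-target j (eval-rep₁₁ j) step₁₁₁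

  eval-rep₀₁ : ∀ j → ev (rep₀₁ j) ≡ target j (+ 0) (+ 1)
  eval-rep₀₁ zero    = trans (eval-∷-offset (1 ∷ []) eval-[1] (step-[u∷1] 0)) (sym (target-zero (+ 0) (+ 1)))
  eval-rep₀₁ (suc j) = eval-∷-target j (eval-rep₁₁ j) step₀₁₁

  eval-reps : ∀ j → All (λ f → ev f ≡ target j (+ 0) (+ 0)) (reps j)
  eval-reps zero    = trans (eval-∷-offset [] origin≡offset step-[t]) (sym (target-zero (+ 0) (+ 0))) All.∷ All.[]
  eval-reps (suc j) = eval-∷-target j (eval-rep₀₁ j) step₀₀₁
    All.∷ Allₚ.map⁺ (All.map (λ f≡ → eval-∷-target j f≡ (step-axis 0)) (eval-reps j))

  LeadingNonzero-rep₁₁ : ∀ j → LeadingNonzero (rep₁₁ j)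
  LeadingNonzero-rep₁₁ zero    = 1 ∷ [] , 1 , refl , λ ()
  LeadingNonzero-rep₁₁ (suc j) = LeadingNonzero-∷ (suc a) (LeadingNonzero-rep₁₁ j)

  LeadingNonzero-rep₀₁ : ∀ j → LeadingNonzero (rep₀₁ j)
  LeadingNonzero-rep₀₁ zero    = 0 ∷ [] , 1 , refl , λ ()
  LeadingNonzero-rep₀₁ (suc j) = LeadingNonzero-∷ a (LeadingNonzero-rep₁₁ j)

  LeadingNonzero-reps : ∀ j → All LeadingNonzero (reps j)
  LeadingNonzero-reps zero    = ([] , T , refl , λ ()) All.∷ All.[]
  LeadingNonzero-reps (suc j) = LeadingNonzero-∷ M (LeadingNonzero-rep₀₁ j)
    All.∷ Allₚ.map⁺ (All.map (LeadingNonzero-∷ 0) (LeadingNonzero-reps j))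

  reps-unique : ∀ j → Unique (reps j)
  reps-unique zero    = All.[] AllPairs.∷ AllPairs.[]
  reps-unique (suc j) = Allₚ.map⁺ (All.universal (λ _ ()) (reps j))
    AllPairs.∷ Unique.map⁺ ∷-injectiveʳ (reps-unique j)

  length-reps : ∀ j → length (reps j) ≡ suc j
  length-reps zero    = refl
  length-reps (suc j) = cong suc (trans (length-map (0 ∷_) (reps j)) (length-reps j))

  expansion-count : ∀ n → pβ≡ (+ T) (+ M) (scale (+ T) (powβ (+ T) (+ M) n)) (suc n)
  expansion-count n =
    reps n , reps-unique n , length-reps n ,
    All.zipWith represents (LeadingNonzero-reps n , eval-reps n) , complete
    where
    tβⁿ : Zβ
    tβⁿ = scale (+ T) (powβ (+ T) (+ M) n)
    represents : ∀ {f} → LeadingNonzero f × ev f ≡ target n (+ 0) (+ 0) → IsRep (+ T) (+ M) tβⁿ f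
    represents (lnz , f≡) = lnz , trans f≡ (target-origin n)
    complete : ∀ f → IsRep (+ T) (+ M) tβⁿ f → f ∈ reps n
    complete f (lnz , f≡)
      with listed n 0 0 f (≤-reflexive (trans (*-zeroʳ K) (sym (*-zeroʳ M))))
                      (LeadingNonzero⇒NoTrailingZero f lnz) (trans f≡ (sym (target-origin n)))
    ... | listed₀₀ f∈ = f∈

module Parameters where
  open import Data.Nat using (_+_; _*_; _<_)
  open import Data.Nat.Properties
  open import Data.Nat.Tactic.RingSolver using (solve)

  parameters : ∀ T a → 4 + (T + a) < 2 * T → Σ[ K ∈ ℕ ] T ≡ 2 + K × 2 + K + a < 2 * K
  parameters 0             a ()
  parameters 1             a (s≤s (s≤s ()))
  parameters (suc (suc K)) a 4+T+a<2T = K , refl , +-cancelˡ-< 4 (2 + K + a) (2 * K) (begin-strict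
    4 + (2 + K + a) <⟨ 4+T+a<2T ⟩
    2 * (2 + K)     ≡⟨ solve (K ∷ []) ⟩
    4 + 2 * K       ∎)
    where open ≤-Reasoning

  4+M<2T : ∀ {T M} → + M ℤ.< + 2 ℤ.* + T ℤ.- + 4 → 4 + M < 2 * T
  4+M<2T {T} {M} M<2T-4 = ℤ.drop‿+<+ (subst (+ (4 + M) ℤ.<_) 4+[2T-4]≡2T (ℤ.+-monoʳ-< (+ 4) M<2T-4))
    where
    open import Data.Integer.Tactic.RingSolver using (solve-∀)
    4+[x-4]≡x : ∀ x → + 4 ℤ.+ (x ℤ.- + 4) ≡ x
    4+[x-4]≡x = solve-∀
    4+[2T-4]≡2T : + 4 ℤ.+ (+ 2 ℤ.* + T ℤ.- + 4) ≡ + (2 * T)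
    4+[2T-4]≡2T = trans (4+[x-4]≡x (+ 2 ℤ.* + T)) (sym (ℤ.pos-* 2 T))

open import Data.Integer using (_+_; _-_; _*_; _<_; _≤_)

theorem2 : (t m : ℤ) → IrreducibleQuad t m →
    + 0 < t * t - + 4 * m → + 0 < t → + 0 < m →
    t ≤ m → m < + 2 * t - + 4 →
    (n : ℕ) → pβ≡ t m (scale t (powβ t m n)) (suc n)
theorem2 (+ T) (+ M) _ _ _ _ t≤m m<2t-4 n with ℕ.m≤n⇒∃[o]m+o≡n (ℤ.drop‿+≤+ t≤m)
... | a , refl with Parameters.parameters T a (Parameters.4+M<2T {T} {T ℕ.+ a} m<2t-4)
... | K , refl , M<2K = Expansions.expansion-count K a M<2K n
theorem2 (+ _)    -[1+ _ ] _ _ _ () _ _ _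
theorem2 -[1+ _ ] _        _ _ () _ _ _ _
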